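{- There is a function $D:\omega\to\omega$ such that every finite $S\subseteq\omega$ satisfies $|\mathrm{Crit}(S)|\le D(|S|)$.
   Context: Conventions. $\mathcal L=\{U_0,\dots,U_{k-1};R_0,\dots,R_{k-1}\}$ is a finite relational language, $U_i$ unary, $R_i$ binary, and all $\mathcal L$-structures $\mathbf A$ satisfy: every $R_i^{\mathbf A}$ is irreflexive; $\mathbf A=\bigsqcup_{i<k}U_i^{\mathbf A}$; $\mathbf A^2\setminus\{(a,a):a\in\mathbf A\}=\bigsqcup_{i<k}R_i^{\mathbf A}$; and there is $\mathrm{Flip}:k\to k$ with $\mathrm{Flip}^2=\mathrm{id}$, $\mathrm{Flip}(0)=0$, such that $R^{\mathbf A}(a,b)=i$ iff $R^{\mathbf A}(b,a)=\mathrm{Flip}(i)$, where $R^{\mathbf A}(a,b)=i$ means $R_i^{\mathbf A}(a,b)$; $R_0$ plays the role of "no relation". An $\mathcal L$-structure $\mathbf F$ is irreducible if $R^{\mathbf F}(a,b)\ne0$ for all $a\ne b$ in $\mathbf F$. $\mathcal F$ is a finite set of finite irreducible $\mathcal L$-structures and $\mathcal K=\mathrm{Forb}(\mathcal F)$ is the class of finite $\mathcal L$-structures into which no member of $\mathcal F$ embeds (a Fraïssé class with free amalgamation). $\mathbf K$ is a Fraïssé limit of $\mathcal K$ with underlying set $\omega$; $\mathbf K_m$ is its induced substructure on $\{0,\dots,m-1\}$; $\mathbf K$ is left dense: for every $m<\omega$ and every $\mathbf A\in\mathcal K$ with underlying set $m+1$ whose induced substructure on $m$ equals $\mathbf K_m$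 there is $n\ge m$ such that $i\mapsto i$ ($i<m$), $m\mapsto n$ is an embedding $\mathbf A\to\mathbf K$ and $R^{\mathbf K}(r,n)=0$ for $m\le r<n$. Write $R=R^{\mathbf K}$. Trees. $T=k^{<\omega}$, $T(n)=k^n$; $s|_n$ is the restriction of $s$ to length $n$; $\pi_m$ is restriction to length $m$. The coding node $c(j)\in T(j)$ for $j<\omega$ is given by $c(j)(i)=R(i,j)$ for $i<j$. For finite $S\subseteq\omega$ and $m<\omega$, $c[S]|_{m+1}=\{c(a)|_{m+1}: a\in S,\ a\ge m+1\}$. Labeled structures and age maps. For a finite set $X$, an $X$-labeled structure is a finite $\mathcal L$-structure $\mathbf B$ with a map $\phi:\mathbf B\to X$. For $m<\omega$ and a $T(m)$-labeled $(\mathbf B,\phi)$ with $\mathbf B\cap\omega=\emptyset$, $\mathbf B[\phi]$ is the $\mathcal L$-structure on $\mathbf B\cup\mathbf K_m$ with $\mathbf B$ and $\mathbf K_m$ as induced substructures and $R(i,b)=\phi(b)(i)$ for $i<m$, $b\in\mathbf B$. $\mathcal C(m)$ is the class of $T(m)$-labeled $(\mathbf B,\phi)$ with $\mathbf B[\phi]\in\mathcal K$, and a subset $X\subseteq T(m)$ carries the class of $X$-labeled structures in $\mathcal C(m)$. A map $f:X\to Y$ between such subsets ($X\subseteq T(m)$, $Y\subseteq T(n)$) is an age map if it is injective and for every $X$-labeled $(\mathbf B,\phi)$: $\mathbf B[\phi]\in\mathcal K$ iff $\mathbf B[f\circ\phi]\in\mathcal K$. Critical values. For finite $S\subseteq\omega$,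 $\mathrm{Crit}(S)$ is the set of $m<\max(S)$ for which $\pi_m:c[S]|_{m+1}\to T(m)$ is not an age map (in particular, if it is not injective). -}

module Defs where

open import Data.Nat using (ℕ; zero; suc; _≤_; _<_; _⊔_; _<ᵇ_)
open import Data.Nat.Properties using (n≤1+n)
open import Data.Bool using (if_then_else_)
open import Data.Fin using (Fin; toℕ; inject≤; inject₁) renaming (zero to fzero)
open import Data.Vec using (Vec; tabulate; lookup)
open import Data.List using (List; foldr)
open import Data.List.Membership.Propositional using (_∈_)
open import Data.Product using (Σ; _×_; _,_; proj₁; proj₂)
open import Data.Sum using (_⊎_; inj₁; inj₂)
open import Relation.Nullary using (¬_)
open import Relation.Binary.PropositionalEquality using (_≡_; _≢_)
open import Function.Bundles using (_⇔_)

-- The partition conventions are built in: the unary part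
-- is a function C → Fin k (each element in exactly one U_i), and the
-- binary part is a function C → C → Fin k whose value R a b = i means
-- R_i(a,b); only its values on pairs a ≢ b are meaningful
-- (irreflexivity: the diagonal is ignored everywhere below).

record Str (k : ℕ) (C : Set) : Set where
  constructor mkStr
  field
    U : C → Fin k
    R : C → C → Fin k
open Str public

Valid : ∀ {k} {C : Set} → (Fin k → Fin k) → Str k C → Set
Valid Flip A = ∀ a b → a ≢ b → R A b a ≡ Flip (R A a b)

-- irreducible: R(a,b) ≠ 0 for all a ≠ b   (R_0 = "no relation")
Irreducible : ∀ {k} {C : Set} → Str (suc k) C → Set
Irreducible A = ∀ a b → a ≢ b → R A a b ≢ fzero

IsEmb : ∀ {k} {C D : Set} → Str k C → Str k D → (C → D) → Set
IsEmb A B e =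
  (∀ a b → e a ≡ e b → a ≡ b) ×
  (∀ a → U B (e a) ≡ U A a) ×
  (∀ a b → a ≢ b → R B (e a) (e b) ≡ R A a b)

-- pulling back a structure along a map (along an injection: the induced
-- substructure on the image, transported to the domain)
pull : ∀ {k} {C D : Set} → Str k D → (C → D) → Str k C
pull A e = mkStr (λ c → U A (e c)) (λ c d → R A (e c) (e d))

SameStr : ∀ {k} {C : Set} → Str k C → Str k C → Set
SameStr A B = (∀ a → U A a ≡ U B a) × (∀ a b → a ≢ b → R A a b ≡ R B a b)

FinStr : ℕ → Set
FinStr k = Σ ℕ λ n → Str k (Fin n)

Forb : ∀ {k} {C : Set} → List (FinStr k) → Str k C → Set
Forb {C = C} ℱ A = ∀ {F} → F ∈ ℱ → ¬ (Σ (Fin (proj₁ F) → C) λ e → IsEmb (proj₂ F) A e)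

InK : ∀ {k} {C : Set} → (Fin k → Fin k) → List (FinStr k) → Str k C → Set
InK Flip ℱ A = Valid Flip A × Forb ℱ A

FraisseLimit : ∀ {k} → (Fin k → Fin k) → List (FinStr k) → Str k ℕ → Set
FraisseLimit Flip ℱ K =
  Valid Flip K ×
  -- age(K) ⊆ 𝒦
  (∀ n (e : Fin n → ℕ) → (∀ a b → e a ≡ e b → a ≡ b) → InK Flip ℱ (pull K e)) ×
  -- 𝒦 ⊆ age(K)
  (∀ n (A : Str _ (Fin n)) → InK Flip ℱ A → Σ (Fin n → ℕ) λ e → IsEmb A K e) ×
  -- ultrahomogeneity: every isomorphism e₁(a) ↦ e₂(a) between finite
  -- substructures extends to an automorphism σ of K
  (∀ n (e₁ e₂ : Fin n → ℕ) → (∀ a b → e₁ a ≡ e₁ b → a ≡ b) →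
     IsEmb (pull K e₁) K e₂ →
     Σ (ℕ → ℕ) λ σ → IsEmb K K σ × (∀ y → Σ ℕ λ x → σ x ≡ y) ×
                     (∀ a → σ (e₁ a) ≡ e₂ a))

Kres : ∀ {k} → Str k ℕ → (m : ℕ) → Str k (Fin m)
Kres K m = pull K toℕ

ext : (m n : ℕ) → Fin (suc m) → ℕ
ext m n i = if toℕ i <ᵇ m then toℕ i else n

LeftDense : ∀ {k} → (Fin (suc k) → Fin (suc k)) → List (FinStr (suc k)) → Str (suc k) ℕ → Set
LeftDense Flip ℱ K =
  ∀ m (A : Str _ (Fin (suc m))) → InK Flip ℱ A →
  SameStr (pull A inject₁) (Kres K m) →
  Σ ℕ λ n → m ≤ n × IsEmb A K (ext m n) ×
            (∀ r → m ≤ r → r < n → R K r n ≡ fzero)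

T : ℕ → ℕ → Set
T k m = Vec (Fin k) m

restrict : ∀ {k m n} → m ≤ n → T k n → T k m
restrict p s = tabulate λ i → lookup s (inject≤ i p)

π : ∀ {k} m → T k (suc m) → T k m
π m = restrict (n≤1+n m)

code : ∀ {k} → Str k ℕ → (j : ℕ) → T k j
code K j = tabulate λ i → R K (toℕ i) j

glue : ∀ {k} {C : Set} → (Fin k → Fin k) → Str k ℕ → (m : ℕ) →
       Str k C → (C → T k m) → Str k (Fin m ⊎ C)
glue Flip K m B φ = mkStr u r
  where
  u : _ → _
  u (inj₁ i) = U K (toℕ i)
  u (inj₂ b) = U B b
  r : _ → _ → _
  r (inj₁ i) (inj₁ j) = R K (toℕ i) (toℕ j)
  r (inj₂ a) (inj₂ b) = R B a b
  r (inj₁ i) (inj₂ b) = lookup (φ b) i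
  r (inj₂ b) (inj₁ i) = Flip (lookup (φ b) i)

-- f : X → Y (X ⊆ T(m), Y ⊆ T(n)) is an age map.  X is given as a
-- predicate on T(m); Y plays no role beyond containing the image.
IsAgeMap : ∀ {k} → (Fin k → Fin k) → List (FinStr k) → Str k ℕ →
           {m n : ℕ} → (T k m → Set) → (T k m → T k n) → Set
IsAgeMap {k} Flip ℱ K {m} {n} X f =
  (∀ u v → X u → X v → f u ≡ f v → u ≡ v) ×
  (∀ b (B : Str k (Fin b)) → Valid Flip B →
     (φ : Fin b → T k m) → (∀ x → X (φ x)) →
     InK Flip ℱ (glue Flip K m B φ) ⇔ InK Flip ℱ (glue Flip K n B (λ x → f (φ x))))

InCS : ∀ {k} → Str k ℕ → List ℕ → (m : ℕ) → T k (suc m) → Set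
InCS K S m v = Σ ℕ λ a → a ∈ S × Σ (suc m ≤ a) λ p → v ≡ restrict p (code K a)

maxL : List ℕ → ℕ
maxL = foldr _⊔_ 0

Crit : ∀ {k} → (Fin k → Fin k) → List (FinStr k) → Str k ℕ → List ℕ → ℕ → Set
Crit Flip ℱ K S m = m < maxL S × ¬ IsAgeMap Flip ℱ K (InCS K S m) (π m)

module Submission where

-- We attach to
-- every finite S a FINITE set of witnesses whose size depends only on |S| (and on ℱ), each with
-- a property of levels that is downward closed:
--   * a pair (a, b) of positions in S holds at n if the coding nodes of S_a and S_b agree below n;
--   * a trace (a member F of ℱ together with a labelling of F's elements by "in K" or "over the
--     coding node of S_a") holds at n if the induced labelled structure glued onto K_n is in 𝒦.
-- If no witness changes from "holds" to "fails" between m and m+1, then π_m is injective on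
-- c[S]|_{m+1} (pairs) and reflects membership in 𝒦 (traces: the trace of a forbidden copy in
-- B[φ] would change at m); it always preserves membership since 𝒦 is hereditary.  Hence every
-- critical value is (constructively, not-not) a transition point of some witness.  A downward
-- closed property has at most one transition point, so there are at most |witnesses| critical
-- values.

open import Defs
open import Level using (0ℓ)
open import Data.Nat using (ℕ; suc; _≤_; _*_; _+_; _^_; _≤?_; _≤′_; ≤′-refl; ≤′-step)
open import Data.Nat.Properties using (n≤1+n; ≤⇒≤′; <-cmp; m≤m⊔n; m≤n⊔m; ≤-trans; ^-monoʳ-≤)
open import Data.Fin as Fin using (Fin; toℕ; inject≤; combine) renaming (zero to fzero; suc to fsuc)
open import Data.Fin.Properties
  using (toℕ-injective; toℕ-inject≤; inject≤-injective; combine-injective; injective⇒≤;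
         suc-injective; +↔⊎; *↔×)
open import Data.Vec using (Vec; []; _∷_; tabulate; lookup)
open import Data.Vec.Properties using (lookup∘tabulate; tabulate-cong; ≡-dec)
open import Data.List as List using (List; length; []; _∷_)
open import Data.List.Relation.Unary.All as All using (All)
open import Data.List.Relation.Unary.AllPairs using (_∷_)
open import Data.List.Relation.Unary.Any using (here; there; index)
open import Data.List.Relation.Unary.Any.Properties using (lookup-index)
open import Data.List.Membership.Propositional using (_∈_)
open import Data.List.Membership.Propositional.Properties using (∈-lookup)
open import Data.List.Relation.Unary.Unique.Propositional using (Unique)
open import Data.Product using (Σ; _×_; _,_; proj₁; proj₂)
open import Data.Sum using (_⊎_; inj₁; inj₂; map₁; map₂)
open import Data.Sum.Properties using (inj₁-injective; inj₂-injective)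
open import Data.Empty using (⊥-elim)
open import Relation.Nullary using (¬_)
open import Relation.Nullary.Decidable using (decidable-stable)
open import Relation.Nullary.Negation using (¬¬-Monad)
open import Relation.Binary using (tri<; tri≈; tri>)
open import Relation.Binary.PropositionalEquality
  using (_≡_; _≢_; refl; sym; trans; cong; cong₂; module ≡-Reasoning)
open import Axiom.UniquenessOfIdentityProofs using (module Decidable⇒UIP)
open import Effect.Monad using (RawMonad)
open import Function using (_∘_)
open import Function.Bundles using (Injection; _↣_; mk↣; mk⇔)
open import Function.Properties.Inverse using (↔⇒↣; ↔-sym)
open import Function.Construct.Composition using (_↣-∘_)
open import Data.Sum.Function.Propositional using (_⊎-↣_)

-- Finite codings.  A type is shown finite by an injection into some Fin M.

vec↣ : ∀ {c n} → Vec (Fin c) n ↣ Fin (c ^ n)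
vec↣ = mk↣ {to = digits} injective
  where
  digits : ∀ {c n} → Vec (Fin c) n → Fin (c ^ n)
  digits []       = fzero
  digits (x ∷ xs) = combine x (digits xs)

  injective : ∀ {c n} {u v : Vec (Fin c) n} → digits u ≡ digits v → u ≡ v
  injective {u = []}    {[]}    _  = refl
  injective {u = x ∷ u} {y ∷ v} eq with combine-injective x (digits u) y (digits v) eq
  ... | refl , eq′ = cong (x ∷_) (injective eq′)

Σ↣ : ∀ {n M} {B : Fin n → Set} → (∀ i → B i ↣ Fin M) → Σ (Fin n) B ↣ Fin (n * M)
Σ↣ {n} {M} {B} f = mk↣ {to = pairing} injective
  where
  pairing : Σ (Fin n) B → Fin (n * M)
  pairing (i , x) = combine i (Injection.to (f i) x)

  injective : ∀ {p q} → pairing p ≡ pairing q → p ≡ q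
  injective {i , x} {j , y} eq with combine-injective i _ j _ eq
  ... | refl , eq′ = cong (i ,_) (Injection.injective (f i) eq′)

inject≤↣ : ∀ {m n} → m ≤ n → Fin m ↣ Fin n
inject≤↣ p = mk↣ {to = λ i → inject≤ i p} λ {i} {j} → inject≤-injective p p i j

lookup-injective : ∀ {A : Set} {L : List A} → Unique L →
                   ∀ {i j} → List.lookup L i ≡ List.lookup L j → i ≡ j
lookup-injective (_ ∷ _)  {fzero}  {fzero}  _  = refl
lookup-injective (x∉ ∷ _) {fzero}  {fsuc j} eq = ⊥-elim (All.lookup x∉ (∈-lookup j) eq)
lookup-injective (x∉ ∷ _) {fsuc i} {fzero}  eq = ⊥-elim (All.lookup x∉ (∈-lookup i) (sym eq))
lookup-injective (_ ∷ u)  {fsuc i} {fsuc j} eq = cong fsuc (lookup-injective u eq)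

-- A level m is a transition point of a if Q a m holds and Q a (m+1) fails.  Each a has at
-- most one, so if A is coded below M, at most M distinct levels are transition points.
module Transitions {A : Set} (Q : A → ℕ → Set) (Q-step : ∀ a n → Q a (suc n) → Q a n) where

  Transition : ℕ → Set
  Transition m = Σ A λ a → Q a m × ¬ Q a (suc m)

  Q-antitone : ∀ {a m n} → m ≤′ n → Q a n → Q a m
  Q-antitone ≤′-refl       q = q
  Q-antitone (≤′-step m≤n) q = Q-antitone m≤n (Q-step _ _ q)

  transition-unique : ∀ {m n} (x : Transition m) (y : Transition n) → proj₁ x ≡ proj₁ y → m ≡ n
  transition-unique {m} {n} (a , Qm , ¬Qm+1) (.a , Qn , ¬Qn+1) refl with <-cmp m n
  ... | tri< m<n _ _   = ⊥-elim (¬Qm+1 (Q-antitone (≤⇒≤′ m<n) Qn))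
  ... | tri≈ _ m≡n _   = m≡n
  ... | tri> _ _ n<m   = ⊥-elim (¬Qn+1 (Q-antitone (≤⇒≤′ n<m) Qm))

  -- distinct transition points have distinct witnesses, hence distinct codes below M
  transitions-bounded : ∀ {M L} → A ↣ Fin M → Unique L → All Transition L → length L ≤ M
  transitions-bounded {L = L} enc unique ts = injective⇒≤ {f = witnessCode} injective
    where
    witness : (i : Fin (length L)) → Transition (List.lookup L i)
    witness i = All.lookup ts (∈-lookup i)

    witnessCode : Fin (length L) → Fin _
    witnessCode i = Injection.to enc (proj₁ (witness i))

    injective : ∀ {i j} → witnessCode i ≡ witnessCode j → i ≡ j
    injective {i} {j} eq =
      lookup-injective unique (transition-unique (witness i) (witness j) (Injection.injective enc eq))

  -- the bound is decidable, so it suffices that no listed level fails to be a transition point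
  ¬¬transitions-bounded : ∀ {M L} → A ↣ Fin M → Unique L →
                          All (λ m → ¬ ¬ Transition m) L → length L ≤ M
  ¬¬transitions-bounded enc unique ts = decidable-stable (_ ≤? _) λ too-long →
    All.sequenceA 0ℓ rawApplicative ts λ ts′ → too-long (transitions-bounded enc unique ts′)
    where open RawMonad ¬¬-Monad

module _ {k : ℕ} {A B C : Set} {𝔸 : Str k A} {𝔹 : Str k B} {ℂ : Str k C} where

  IsEmb-∘ : ∀ {f : B → C} {g : A → B} → IsEmb 𝔹 ℂ f → IsEmb 𝔸 𝔹 g → IsEmb 𝔸 ℂ (f ∘ g)
  IsEmb-∘ (f-inj , f-U , f-R) (g-inj , g-U , g-R) =
    (λ a a′ → g-inj a a′ ∘ f-inj _ _) ,
    (λ a → trans (f-U _) (g-U a)) ,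
    (λ a a′ a≢a′ → trans (f-R _ _ (a≢a′ ∘ g-inj a a′)) (g-R a a′ a≢a′))

  IsEmb-cancel : ∀ {f : A → C} {g : B → A} {e : B → C} →
                 IsEmb 𝔸 ℂ f → (∀ x → f (g x) ≡ e x) → IsEmb 𝔹 ℂ e → IsEmb 𝔹 𝔸 g
  IsEmb-cancel {f} {g} {e} (_ , f-U , f-R) fg≡e (e-inj , e-U , e-R) = g-inj , g-U , g-R
    where
    g-inj : ∀ x y → g x ≡ g y → x ≡ y
    g-inj x y eq = e-inj x y (trans (sym (fg≡e x)) (trans (cong f eq) (fg≡e y)))

    g-U : ∀ x → U 𝔸 (g x) ≡ U 𝔹 x
    g-U x = trans (sym (f-U (g x))) (trans (cong (U ℂ) (fg≡e x)) (e-U x))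

    g-R : ∀ x y → x ≢ y → R 𝔸 (g x) (g y) ≡ R 𝔹 x y
    g-R x y x≢y = trans (sym (f-R _ _ (x≢y ∘ g-inj x y)))
                        (trans (cong₂ (R ℂ) (fg≡e x) (fg≡e y)) (e-R x y x≢y))

InK-pull : ∀ {k} {A B : Set} {𝔸 : Str k A} {𝔹 : Str k B} {e : A → B} {Flip ℱ} →
           IsEmb 𝔸 𝔹 e → InK Flip ℱ 𝔹 → InK Flip ℱ 𝔸
InK-pull {𝔸 = 𝔸} {𝔹} {e} {Flip} emb@(e-inj , _ , e-R) (𝔹-valid , 𝔹-forb) =
  valid , λ {F} F∈ (g , g-emb) →
    𝔹-forb F∈ (e ∘ g , IsEmb-∘ {𝔸 = proj₂ F} {𝔹 = 𝔸} {ℂ = 𝔹} emb g-emb)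
  where
  open ≡-Reasoning
  valid : Valid Flip 𝔸
  valid a b a≢b = begin
    R 𝔸 b a                 ≡⟨ sym (e-R b a (a≢b ∘ sym)) ⟩
    R 𝔹 (e b) (e a)         ≡⟨ 𝔹-valid (e a) (e b) (a≢b ∘ e-inj a b) ⟩
    Flip (R 𝔹 (e a) (e b))  ≡⟨ cong Flip (e-R a b a≢b) ⟩
    Flip (R 𝔸 a b)          ∎

embeds-at-index : ∀ {k} {C : Set} {ℱ : List (FinStr k)} {F} {𝔾 : Str k C} (F∈ : F ∈ ℱ) →
  Σ (Fin (proj₁ F) → C) (IsEmb (proj₂ F) 𝔾) →
  Σ (Fin (proj₁ (List.lookup ℱ (index F∈))) → C) (IsEmb (proj₂ (List.lookup ℱ (index F∈))) 𝔾)
embeds-at-index (here refl) copy = copy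
embeds-at-index {𝔾 = 𝔾} (there F∈) copy = embeds-at-index {𝔾 = 𝔾} F∈ copy

size≤maxSize : ∀ {k} (ℱ : List (FinStr k)) i → proj₁ (List.lookup ℱ i) ≤ maxL (List.map proj₁ ℱ)
size≤maxSize (_ ∷ _) fzero    = m≤m⊔n _ _
size≤maxSize (_ ∷ ℱ) (fsuc i) = ≤-trans (size≤maxSize ℱ i) (m≤n⊔m _ _)

module Coding {k : ℕ} (Flip : Fin (suc k) → Fin (suc k)) (K : Str (suc k) ℕ) where

  -- node n a = c(a)|_n for every level n; in particular code K a = node a a
  node : (n a : ℕ) → T (suc k) n
  node n a = tabulate λ i → R K (toℕ i) a

  lookup-restrict : ∀ {m n} (p : m ≤ n) (v : T (suc k) n) i →
                    lookup (restrict p v) i ≡ lookup v (inject≤ i p)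
  lookup-restrict p v i = lookup∘tabulate _ i

  restrict-node : ∀ {m n} (p : m ≤ n) a → restrict p (node n a) ≡ node m a
  restrict-node p a = tabulate-cong λ i →
    trans (lookup∘tabulate _ (inject≤ i p)) (cong (λ t → R K t a) (toℕ-inject≤ i p))

  lookup-node : ∀ {m n} (p : m ≤ n) a i → lookup (node m a) i ≡ lookup (node n a) (inject≤ i p)
  lookup-node p a i =
    trans (cong (λ v → lookup v i) (sym (restrict-node p a))) (lookup-restrict p (node _ a) i)

  inCS-node : ∀ {S m v} → InCS K S m v → Σ (Fin (length S)) λ a → v ≡ node (suc m) (List.lookup S a)
  inCS-node (a , a∈S , p , v≡) =
    index a∈S , trans v≡ (trans (restrict-node p a) (cong (node _) (lookup-index a∈S)))

  glue-mono : ∀ {C m n} (p : m ≤ n) (B : Str (suc k) C)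
              {φ′ : C → T (suc k) m} {φ : C → T (suc k) n} →
              (∀ x i → lookup (φ′ x) i ≡ lookup (φ x) (inject≤ i p)) →
              IsEmb (glue Flip K m B φ′) (glue Flip K n B φ) (map₁ λ i → inject≤ i p)
  glue-mono {C} {m} {n} p B {φ′} {φ} labels = injective , unary , binary
    where
    raise : Fin m ⊎ C → Fin n ⊎ C
    raise = map₁ λ i → inject≤ i p

    injective : ∀ u v → raise u ≡ raise v → u ≡ v
    injective (inj₁ i) (inj₁ j) eq = cong inj₁ (inject≤-injective p p i j (inj₁-injective eq))
    injective (inj₁ _) (inj₂ _) ()
    injective (inj₂ _) (inj₁ _) ()
    injective (inj₂ x) (inj₂ y) refl = refl

    unary : ∀ u → U (glue Flip K n B φ) (raise u) ≡ U (glue Flip K m B φ′) u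
    unary (inj₁ i) = cong (U K) (toℕ-inject≤ i p)
    unary (inj₂ _) = refl

    binary : ∀ u v → u ≢ v → R (glue Flip K n B φ) (raise u) (raise v) ≡ R (glue Flip K m B φ′) u v
    binary (inj₁ i) (inj₁ j) _ = cong₂ (R K) (toℕ-inject≤ i p) (toℕ-inject≤ j p)
    binary (inj₁ i) (inj₂ y) _ = sym (labels y i)
    binary (inj₂ x) (inj₁ j) _ = cong Flip (sym (labels x j))
    binary (inj₂ _) (inj₂ _) _ = refl

  -- π_m always maps labellings in 𝒦 to labellings in 𝒦 (the forward half of being an age map)
  InK-restrict : ∀ {ℱ m b} (B : Str (suc k) (Fin b)) (φ : Fin b → T (suc k) (suc m)) →
                 InK Flip ℱ (glue Flip K (suc m) B φ) → InK Flip ℱ (glue Flip K m B (λ x → π m (φ x)))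
  InK-restrict {ℱ} {m} B φ =
    InK-pull {𝔸 = glue Flip K m B (λ x → π m (φ x))} {𝔹 = glue Flip K (suc m) B φ}
             {Flip = Flip} {ℱ = ℱ}
      (glue-mono (n≤1+n m) B λ x → lookup-restrict (n≤1+n m) (φ x))

  glue-valid : (∀ i → Flip (Flip i) ≡ i) → Valid Flip K → ∀ {C m} {B : Str (suc k) C}
               {φ : C → T (suc k) m} → Valid Flip B → Valid Flip (glue Flip K m B φ)
  glue-valid _     K-valid _       (inj₁ i) (inj₁ j) i≢j = K-valid _ _ (i≢j ∘ cong inj₁ ∘ toℕ-injective)
  glue-valid _     _       _       (inj₁ _) (inj₂ _) _   = refl
  glue-valid Flip² _       _       (inj₂ _) (inj₁ _) _   = sym (Flip² _)
  glue-valid _     _       B-valid (inj₂ x) (inj₂ y) x≢y = B-valid x y (x≢y ∘ cong inj₂)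

module Witnesses {k : ℕ} (Flip : Fin (suc k) → Fin (suc k)) (Flip² : ∀ i → Flip (Flip i) ≡ i)
  (K : Str (suc k) ℕ) (K-valid : Valid Flip K) (ℱ : List (FinStr (suc k))) (S : List ℕ) where

  open Coding Flip K

  s : ℕ
  s = length S

  size : Fin (length ℱ) → ℕ
  size i = proj₁ (List.lookup ℱ i)

  forbidden : (i : Fin (length ℱ)) → Str (suc k) (Fin (size i))
  forbidden i = proj₂ (List.lookup ℱ i)

  -- a trace: a member F of ℱ and, for each element of F, the label 0 ("realised in K") or
  -- 1+a ("realised over the coding node of S_a")
  Trace : Set
  Trace = Σ (Fin (length ℱ)) λ i → Vec (Fin (suc s)) (size i)

  Placed : Trace → Set
  Placed (i , labels) = Σ (Fin (size i)) λ j → Σ (Fin s) λ a → lookup labels j ≡ fsuc a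

  placedAt : (t : Trace) → Placed t → Fin s
  placedAt (_ , _) (_ , a , _) = a

  placed-≡ : ∀ {t} {y y′ : Placed t} → proj₁ y ≡ proj₁ y′ → y ≡ y′
  placed-≡ {_ , _} {j , a , p} {.j , a′ , p′} refl with suc-injective (trans (sym p) p′)
  ... | refl = cong (λ q → j , a , q) (Decidable⇒UIP.≡-irrelevant Fin._≟_ p p′)

  traceStr : (t : Trace) → Str (suc k) (Placed t)
  traceStr (i , _) = pull (forbidden i) proj₁

  traceGlue : (n : ℕ) (t : Trace) → Str (suc k) (Fin n ⊎ Placed t)
  traceGlue n t = glue Flip K n (traceStr t) (λ y → node n (List.lookup S (placedAt t y)))

  Witness : Set
  Witness = (Fin s × Fin s) ⊎ Trace

  Holds : Witness → ℕ → Set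
  Holds (inj₁ (a , b)) n = node n (List.lookup S a) ≡ node n (List.lookup S b)
  Holds (inj₂ t)       n = InK Flip ℱ (traceGlue n t)

  holds-step : ∀ w n → Holds w (suc n) → Holds w n
  holds-step (inj₁ (a , b)) n agree = begin
    node n (List.lookup S a)                   ≡⟨ sym (restrict-node (n≤1+n n) _) ⟩
    π n (node (suc n) (List.lookup S a))       ≡⟨ cong (π n) agree ⟩
    π n (node (suc n) (List.lookup S b))       ≡⟨ restrict-node (n≤1+n n) _ ⟩
    node n (List.lookup S b)                   ∎
    where open ≡-Reasoning
  holds-step (inj₂ t) n =
    InK-pull {𝔸 = traceGlue n t} {𝔹 = traceGlue (suc n) t} {Flip = Flip} {ℱ = ℱ}
      (glue-mono (n≤1+n n) (traceStr t) λ y → lookup-node (n≤1+n n) (List.lookup S (placedAt t y)))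

  open Transitions Holds holds-step public

  witness↣ : Witness ↣ Fin (s * s + length ℱ * suc s ^ maxL (List.map proj₁ ℱ))
  witness↣ = ↔⇒↣ (↔-sym +↔⊎) ↣-∘ (↔⇒↣ (↔-sym *↔×) ⊎-↣ Σ↣ λ i →
               inject≤↣ (^-monoʳ-≤ (suc s) (size≤maxSize ℱ i)) ↣-∘ vec↣)

  -- The trace of e records which elements of F land in B and over
  -- which node; it embeds into B[ψ] at every level where B's labels are these nodes.
  module ForbiddenCopy {m b : ℕ} (B : Str (suc k) (Fin b)) (σ : Fin b → Fin s)
    (φ : Fin b → T (suc k) (suc m)) (φ-node : ∀ x → φ x ≡ node (suc m) (List.lookup S (σ x)))
    (i : Fin (length ℱ)) (e : Fin (size i) → Fin (suc m) ⊎ Fin b)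
    (e-emb : IsEmb (forbidden i) (glue Flip K (suc m) B φ) e) where

    e-inj : ∀ j j′ → e j ≡ e j′ → j ≡ j′
    e-inj = proj₁ e-emb

    e-U : ∀ j → U (glue Flip K (suc m) B φ) (e j) ≡ U (forbidden i) j
    e-U = proj₁ (proj₂ e-emb)

    e-R : ∀ j j′ → j ≢ j′ → R (glue Flip K (suc m) B φ) (e j) (e j′) ≡ R (forbidden i) j j′
    e-R = proj₂ (proj₂ e-emb)

    side : Fin (suc m) ⊎ Fin b → Fin (suc s)
    side (inj₁ _) = fzero
    side (inj₂ x) = fsuc (σ x)

    trace : Trace
    trace = i , tabulate (side ∘ e)

    side-view : ∀ v {a} → side v ≡ fsuc a → Σ (Fin b) λ x → v ≡ inj₂ x × σ x ≡ a
    side-view (inj₁ _) ()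
    side-view (inj₂ x) refl = x , refl , refl

    origin : (y : Placed trace) → Σ (Fin b) λ x → e (proj₁ y) ≡ inj₂ x × σ x ≡ placedAt trace y
    origin (j , a , p) = side-view (e j) (trans (sym (lookup∘tabulate (side ∘ e) j)) p)

    source : Placed trace → Fin b
    source y = proj₁ (origin y)

    e-source : ∀ y → e (proj₁ y) ≡ inj₂ (source y)
    e-source y = proj₁ (proj₂ (origin y))

    source-node : ∀ y → φ (source y) ≡ node (suc m) (List.lookup S (placedAt trace y))
    source-node y = trans (φ-node _) (cong (node (suc m) ∘ List.lookup S) (proj₂ (proj₂ (origin y))))

    trace-emb : ∀ {n} (ψ : Fin b → T (suc k) n) →
                (∀ y → ψ (source y) ≡ node n (List.lookup S (placedAt trace y))) →
                IsEmb (traceGlue n trace) (glue Flip K n B ψ) (map₂ source)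
    trace-emb {n} ψ ψ-node = injective , unary , binary
      where
      G : Str (suc k) (Fin (suc m) ⊎ Fin b)
      G = glue Flip K (suc m) B φ

      injective : ∀ u v → map₂ source u ≡ map₂ source v → u ≡ v
      injective (inj₁ _) (inj₁ _) refl = refl
      injective (inj₁ _) (inj₂ _) ()
      injective (inj₂ _) (inj₁ _) ()
      injective (inj₂ y) (inj₂ y′) eq =
        cong inj₂ (placed-≡ {trace} (e-inj _ _
          (trans (e-source y) (trans (cong inj₂ (inj₂-injective eq)) (sym (e-source y′))))))

      unary : ∀ u → U (glue Flip K n B ψ) (map₂ source u) ≡ U (traceGlue n trace) u
      unary (inj₁ _) = refl
      unary (inj₂ y) = trans (cong (U G) (sym (e-source y))) (e-U (proj₁ y))

      binary : ∀ u v → u ≢ v →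
               R (glue Flip K n B ψ) (map₂ source u) (map₂ source v) ≡ R (traceGlue n trace) u v
      binary (inj₁ _) (inj₁ _) _ = refl
      binary (inj₁ p) (inj₂ y) _ = cong (λ v → lookup v p) (ψ-node y)
      binary (inj₂ y) (inj₁ p) _ = cong (λ v → Flip (lookup v p)) (ψ-node y)
      binary (inj₂ y) (inj₂ y′) y≢y′ =
        trans (cong₂ (R G) (sym (e-source y)) (sym (e-source y′)))
              (e-R _ _ (λ j≡j′ → y≢y′ (cong inj₂ (placed-≡ {trace} j≡j′))))

    -- every element of F lies in K_{m+1} or is placed, so F lifts to the trace at level m+1
    liftVia : (j : Fin (size i)) (v : Fin (suc m) ⊎ Fin b) → e j ≡ v → Fin (suc m) ⊎ Placed trace
    liftVia j (inj₁ p) _  = inj₁ p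
    liftVia j (inj₂ x) ej = inj₂ (j , σ x , trans (lookup∘tabulate (side ∘ e) j) (cong side ej))

    lift : Fin (size i) → Fin (suc m) ⊎ Placed trace
    lift j = liftVia j (e j) refl

    lift-section : ∀ j → map₂ source (lift j) ≡ e j
    lift-section j = section (e j) refl
      where
      section : ∀ v (ej : e j ≡ v) → map₂ source (liftVia j v ej) ≡ v
      section (inj₁ _) _  = refl
      section (inj₂ _) ej = trans (sym (e-source _)) ej

    -- the trace holds at level m (it sits inside B[π_m ∘ φ] ∈ 𝒦) but fails at m+1 (it contains F)
    copy⇒transition : InK Flip ℱ (glue Flip K m B (λ x → π m (φ x))) → Transition m
    copy⇒transition B∈K = inj₂ trace , holds-below , fails-above
      where
      holds-below : Holds (inj₂ trace) m
      holds-below =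
        InK-pull {𝔸 = traceGlue m trace} {𝔹 = glue Flip K m B (π m ∘ φ)} {Flip = Flip} {ℱ = ℱ}
          (trace-emb (π m ∘ φ) λ y → trans (cong (π m) (source-node y)) (restrict-node (n≤1+n m) _))
          B∈K

      fails-above : ¬ Holds (inj₂ trace) (suc m)
      fails-above (_ , forb) =
        forb (∈-lookup i) (lift , IsEmb-cancel {𝔸 = traceGlue (suc m) trace} {𝔹 = forbidden i}
                                               {ℂ = glue Flip K (suc m) B φ}
                                               (trace-emb φ source-node) lift-section e-emb)

  -- without a transition at m, π_m is injective on c[S]|_{m+1}: nodes agreeing below m agree at m
  π-injective : ∀ {m} → ¬ Transition m →
                ∀ u v → InCS K S m u → InCS K S m v → π m u ≡ π m v → u ≡ v
  π-injective {m} none u v u∈ v∈ πu≡πv with inCS-node u∈ | inCS-node v∈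
  ... | a , refl | b , refl = decidable-stable (≡-dec Fin._≟_ _ _) λ u≢v →
    none (inj₁ (a , b) , agree-below , u≢v)
    where
    agree-below : node m (List.lookup S a) ≡ node m (List.lookup S b)
    agree-below = trans (sym (restrict-node (n≤1+n m) _)) (trans πu≡πv (restrict-node (n≤1+n m) _))

  -- without a transition at m, π_m reflects membership in 𝒦 (the backward half of an age map)
  InK-extend : ∀ {m b} → ¬ Transition m → (B : Str (suc k) (Fin b)) → Valid Flip B →
               (φ : Fin b → T (suc k) (suc m)) → (∀ x → InCS K S m (φ x)) →
               InK Flip ℱ (glue Flip K m B (λ x → π m (φ x))) → InK Flip ℱ (glue Flip K (suc m) B φ)
  InK-extend {m} none B B-valid φ φ∈ B∈K = glue-valid Flip² K-valid B-valid , λ F∈ copy →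
    let (e , e-emb) = embeds-at-index {𝔾 = glue Flip K (suc m) B φ} F∈ copy
    in none (ForbiddenCopy.copy⇒transition B (proj₁ ∘ inCS-node ∘ φ∈) φ (proj₂ ∘ inCS-node ∘ φ∈)
                                          (index F∈) e e-emb B∈K)

  -- a critical level cannot fail to be a transition point: otherwise π_m would be an age map
  critical⇒¬¬transition : ∀ {m} → Crit Flip ℱ K S m → ¬ ¬ Transition m
  critical⇒¬¬transition (_ , not-age-map) none = not-age-map (π-injective none , λ _ B B-valid φ φ∈ →
    mk⇔ (InK-restrict B φ) (InK-extend none B B-valid φ φ∈))

proposition5p2 : (k : ℕ) (Flip : Fin (suc k) → Fin (suc k)) →
    (∀ i → Flip (Flip i) ≡ i) → Flip fzero ≡ fzero →
    (ℱ : List (FinStr (suc k))) →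
    All (λ F → Valid Flip (proj₂ F) × Irreducible (proj₂ F)) ℱ →
    (K : Str (suc k) ℕ) → FraisseLimit Flip ℱ K → LeftDense Flip ℱ K →
    Σ (ℕ → ℕ) λ D → (S : List ℕ) → Unique S →
      (L : List ℕ) → Unique L → All (Crit Flip ℱ K S) L →
      length L ≤ D (length S)
proposition5p2 k Flip Flip² _ ℱ _ K (K-valid , _) _ = bound , bounded
  where
  bound : ℕ → ℕ
  bound s = s * s + length ℱ * suc s ^ maxL (List.map proj₁ ℱ)

  bounded : (S : List ℕ) → Unique S → (L : List ℕ) → Unique L → All (Crit Flip ℱ K S) L →
            length L ≤ bound (length S)
  bounded S _ L L-unique critical =
    ¬¬transitions-bounded witness↣ L-unique (All.map critical⇒¬¬transition critical)
    where open Witnesses Flip Flip² K K-valid ℱ S
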